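{- Let $n\ge3$. (i) Every solution of $(E_3)$ of size $n$ is the quiddity of a weighted (3|4)-decomposition of the first kind of a convex polygon with $n$ vertices. (ii) Every quiddity of a weighted (3|4)-decomposition of the first kind of a convex polygon with $n$ vertices is a solution of $(E_3)$ of size $n$.
   Context: For $a_1,\dots,a_n\in\mathbb{Z}/3\mathbb{Z}$ set $M_n(a_1,\dots,a_n)=\begin{pmatrix}a_n&-1\\1&0\end{pmatrix}\cdots\begin{pmatrix}a_1&-1\\1&0\end{pmatrix}$; an $n$-tuple is a solution of $(E_3)$ of size $n$ if $M_n(a_1,\dots,a_n)=\pm\mathrm{Id}$ over $\mathbb{Z}/3\mathbb{Z}$. A weighted (3|4)-decomposition of the first kind of a convex polygon $P$ with $n$ vertices is a dissection of $P$ by diagonals meeting only at vertices such that every sub-polygon is either a triangle carrying weight $1$ or $-1$, or a quadrilateral carrying weight $0$ (weights in $\mathbb{Z}/3\mathbb{Z}$). Numbering the vertices $1,\dots,n$ starting from any vertex and going clockwise or counterclockwise, the quiddity of the decomposition is $(c_1,\dots,c_n)$ where $c_i$ is the sum of the weights of the sub-polygons having vertex $i$ as a vertex. -}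

module Defs where

open import Data.Nat using (ℕ; zero; suc; _<_; _≟_)
open import Data.Nat.DivMod using (_mod_)
open import Data.Fin using (Fin; toℕ)
open import Data.Vec using (Vec; tabulate; toList)
open import Data.List using (List; []; _∷_; _++_; foldl; foldr)
open import Data.Product using (_×_; _,_)
open import Data.Sum using (_⊎_)
open import Relation.Nullary using (does)
open import Data.Bool using (Bool; if_then_else_; _∨_)
open import Relation.Binary.PropositionalEquality using (_≡_)

Z3 : Set
Z3 = Fin 3

_+₃_ : Z3 → Z3 → Z3
a +₃ b = (toℕ a + toℕ b) mod 3
  where open Data.Nat using (_+_)

_*₃_ : Z3 → Z3 → Z3
a *₃ b = (toℕ a * toℕ b) mod 3
  where open Data.Nat using (_*_)

-₃_ : Z3 → Z3
-₃ a = (3 ∸ toℕ a) mod 3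
  where open Data.Nat using (_∸_)

0₃ 1₃ : Z3
0₃ = 0 mod 3
1₃ = 1 mod 3

record Mat : Set where
  constructor mat
  field
    m11 m12 m21 m22 : Z3

_⊗_ : Mat → Mat → Mat
mat a b c d ⊗ mat e f g h =
  mat ((a *₃ e) +₃ (b *₃ g)) ((a *₃ f) +₃ (b *₃ h))
      ((c *₃ e) +₃ (d *₃ g)) ((c *₃ f) +₃ (d *₃ h))

Id : Mat
Id = mat 1₃ 0₃ 0₃ 1₃

-Id : Mat
-Id = mat (-₃ 1₃) 0₃ 0₃ (-₃ 1₃)

elemM : Z3 → Mat
elemM a = mat a (-₃ 1₃) 1₃ 0₃

-- M_n(a_1,…,a_n) = elemM a_n ⊗ ⋯ ⊗ elemM a_1
Mn : ∀ {n} → Vec Z3 n → Mat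
Mn v = foldl (λ M a → elemM a ⊗ M) Id (toList v)

IsSolutionE3 : ∀ {n} → Vec Z3 n → Set
IsSolutionE3 v = (Mn v ≡ Id) ⊎ (Mn v ≡ -Id)

-- The convex polygon has vertices labelled 1,…,n in cyclic order.

data Sign : Set where
  plus minus : Sign

data Cell : Set where
  tri  : (i k j : ℕ) → Sign → Cell
  quad : (i k l j : ℕ) → Cell

weight : Cell → Z3
weight (tri _ _ _ plus)  = 1₃
weight (tri _ _ _ minus) = -₃ 1₃
weight (quad _ _ _ _)    = 0₃

_=ᵇ_ : ℕ → ℕ → Bool
m =ᵇ n = does (m ≟ n)

hasVertex : ℕ → Cell → Bool
hasVertex v (tri i k j _)  = (v =ᵇ i) ∨ (v =ᵇ k) ∨ (v =ᵇ j)
hasVertex v (quad i k l j) = (v =ᵇ i) ∨ (v =ᵇ k) ∨ (v =ᵇ l) ∨ (v =ᵇ j)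

-- Dissects i j A : the list of cells A is a dissection by non-crossing
-- diagonals of the convex polygon with vertices i, i+1, …, j into
-- triangles and quadrilaterals (for j = i+1 the "polygon" is just the
-- side {i, i+1} and the dissection is empty).  The cell containing the
-- side {i, j} is either a triangle (i,k,j) or a quadrilateral (i,k,l,j),
-- and the remaining regions are dissected recursively.
data Dissects : ℕ → ℕ → List Cell → Set where
  edge : ∀ {i} → Dissects i (suc i) []
  tri  : ∀ {i k j A B} (s : Sign) → i < k → k < j →
         Dissects i k A → Dissects k j B →
         Dissects i j (tri i k j s ∷ A ++ B)
  quad : ∀ {i k l j A B C} → i < k → k < l → l < j →
         Dissects i k A → Dissects k l B → Dissects l j C →
         Dissects i j (quad i k l j ∷ A ++ B ++ C)

Decomposition : ℕ → List Cell → Set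
Decomposition n A = Dissects 1 n A

quiddityAt : List Cell → ℕ → Z3
quiddityAt A v = foldr (λ c s → (if hasVertex v c then weight c else 0₃) +₃ s) 0₃ A

quiddity : (n : ℕ) → List Cell → Vec Z3 n
quiddity n A = tabulate (λ i → quiddityAt A (suc (toℕ i)))

{-# OPTIONS --safe #-}
-- Write E a for the matrix (a −1 ; 1 0) and compare products of such matrices up to sign.
-- Over ℤ/3ℤ one has E a E 0 E b = −E (a + b), E 0 E 0 = −Id and E ε E ε E ε = ±Id for ε = ±1.
-- With these relations, gluing the closed words (products ±Id) of two or three sub-polygons
-- through a triangle of weight ε or a quadrilateral of weight 0 again yields a closed word;
-- induction along the dissection gives (ii).  Conversely, take a solution c_1, …, c_n with
-- n ≥ 3.  If c_1 = ε ≠ 0, vertex 1 is an ear (1, 2, n): subtracting ε from c_2 and c_n leaves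
-- a solution on 2, …, n; symmetrically if c_n ≠ 0.  If c_1 = c_n = 0, then c_2, …, c_{n-1} is
-- a solution, cut off by the quadrilateral (1, 2, n−1, n).  The only solution of size 2 is
-- (0, 0), the bare side of the polygon, so induction gives (i).  Both arguments are carried
-- out for an arbitrary sub-polygon with vertices i, i+1, …, j, the generality that the
-- induction along a dissection needs.
module Submission where

open import Defs
open import Data.Nat using (ℕ; zero; suc; _+_; _≤_; _<_; z≤n; s≤s; _≤?_; _≟_)
open import Data.Nat.Properties
open import Data.Fin using (Fin; zero; suc; toℕ) renaming (_≟_ to _≟₃_)
open import Data.Fin.Properties using (all?; toℕ<n)
open import Data.Sum as Sum using (_⊎_; inj₁; inj₂)
open import Data.Product using (Σ; ∃; _×_; _,_; proj₁; proj₂)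
open import Data.Empty using (⊥-elim)
open import Data.List using (List; []; _∷_; _++_; foldl)
open import Data.Vec using (Vec; []; _∷_; tabulate; toList; lookup)
open import Data.Vec.Properties using (tabulate-cong; tabulate∘lookup)
open import Data.Bool using (true; false; if_then_else_)
open import Data.Bool.Properties using (∨-zeroʳ)
open import Data.List.Relation.Binary.Pointwise using (Pointwise-≡⇒≡; []; _∷_)
open import Function using (_∘_)
open import Relation.Nullary using (¬_; Dec; yes; no; does)
open import Relation.Nullary.Decidable using (dec-true; dec-false; from-yes; map′; ¬?; _×-dec_; _⊎-dec_; _→-dec_)
open import Relation.Binary.Bundles using (Setoid)
open import Relation.Binary.Structures using (IsEquivalence)
open import Relation.Binary.PropositionalEquality
import Relation.Binary.Reasoning.Setoid as SetoidReasoning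

_-₃_ : Z3 → Z3 → Z3
a -₃ b = a +₃ (-₃ b)

+₃-identityˡ : ∀ a → 0₃ +₃ a ≡ a
+₃-identityˡ = from-yes (all? λ a → 0₃ +₃ a ≟₃ a)

+₃-identityʳ : ∀ a → a +₃ 0₃ ≡ a
+₃-identityʳ = from-yes (all? λ a → a +₃ 0₃ ≟₃ a)

+₃-assoc : ∀ a b c → (a +₃ b) +₃ c ≡ a +₃ (b +₃ c)
+₃-assoc = from-yes (all? λ a → all? λ b → all? λ c → (a +₃ b) +₃ c ≟₃ a +₃ (b +₃ c))

+₃-leftComm : ∀ a b c → a +₃ (b +₃ c) ≡ b +₃ (a +₃ c)
+₃-leftComm = from-yes (all? λ a → all? λ b → all? λ c → a +₃ (b +₃ c) ≟₃ b +₃ (a +₃ c))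

a+[b-a]≡b : ∀ a b → a +₃ (b -₃ a) ≡ b
a+[b-a]≡b = from-yes (all? λ a → all? λ b → a +₃ (b -₃ a) ≟₃ b)

infix 4 _≟ᴹ_
_≟ᴹ_ : (M N : Mat) → Dec (M ≡ N)
mat a b c d ≟ᴹ mat a′ b′ c′ d′ =
  map′ (λ { (refl , refl , refl , refl) → refl }) (λ { refl → refl , refl , refl , refl })
       (a ≟₃ a′ ×-dec b ≟₃ b′ ×-dec c ≟₃ c′ ×-dec d ≟₃ d′)

allᴹ? : {P : Mat → Set} → ((M : Mat) → Dec (P M)) → Dec ((M : Mat) → P M)
allᴹ? P? = map′ (λ h → λ { (mat a b c d) → h a b c d }) (λ h a b c d → h (mat a b c d))
                (all? λ a → all? λ b → all? λ c → all? λ d → P? (mat a b c d))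

⊗-identityˡ : ∀ M → Id ⊗ M ≡ M
⊗-identityˡ = from-yes (allᴹ? λ M → Id ⊗ M ≟ᴹ M)

⊗-identityʳ : ∀ M → M ⊗ Id ≡ M
⊗-identityʳ = from-yes (allᴹ? λ M → M ⊗ Id ≟ᴹ M)

-Id-central : ∀ M → M ⊗ -Id ≡ -Id ⊗ M
-Id-central = from-yes (allᴹ? λ M → M ⊗ -Id ≟ᴹ -Id ⊗ M)

⊗-entry-assoc : ∀ a b e f g h i k →
  (((a *₃ e) +₃ (b *₃ g)) *₃ i) +₃ (((a *₃ f) +₃ (b *₃ h)) *₃ k)
    ≡ (a *₃ ((e *₃ i) +₃ (f *₃ k))) +₃ (b *₃ ((g *₃ i) +₃ (h *₃ k)))
⊗-entry-assoc = from-yes (all? λ a → all? λ b → all? λ e → all? λ f → all? λ g → all? λ h → all? λ i → all? λ k →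
  (((a *₃ e) +₃ (b *₃ g)) *₃ i) +₃ (((a *₃ f) +₃ (b *₃ h)) *₃ k)
    ≟₃ (a *₃ ((e *₃ i) +₃ (f *₃ k))) +₃ (b *₃ ((g *₃ i) +₃ (h *₃ k))))

⊗-assoc : ∀ L M N → (L ⊗ M) ⊗ N ≡ L ⊗ (M ⊗ N)
⊗-assoc (mat a b c d) (mat e f g h) (mat i j k l)
  = mat-cong (⊗-entry-assoc a b e f g h i k) (⊗-entry-assoc a b e f g h j l)
             (⊗-entry-assoc c d e f g h i k) (⊗-entry-assoc c d e f g h j l)
  where
  mat-cong : ∀ {a a′ b b′ c c′ d d′} → a ≡ a′ → b ≡ b′ → c ≡ c′ → d ≡ d′ → mat a b c d ≡ mat a′ b′ c′ d′
  mat-cong refl refl refl refl = refl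

infix 4 _≈±_ _≈±?_

_≈±_ : Mat → Mat → Set
M ≈± N = M ≡ N ⊎ M ≡ -Id ⊗ N

_≈±?_ : (M N : Mat) → Dec (M ≈± N)
M ≈±? N = M ≟ᴹ N ⊎-dec M ≟ᴹ -Id ⊗ N

-Id-involutive : ∀ M → -Id ⊗ (-Id ⊗ M) ≡ M
-Id-involutive M = trans (sym (⊗-assoc -Id -Id M)) (⊗-identityˡ M)

≈±-isEquivalence : IsEquivalence _≈±_
≈±-isEquivalence = record { refl = inj₁ refl ; sym = sym± ; trans = trans± }
  where
  sym± : ∀ {M N} → M ≈± N → N ≈± M
  sym± (inj₁ p) = inj₁ (sym p)
  sym± {N = N} (inj₂ p) = inj₂ (trans (sym (-Id-involutive N)) (cong (-Id ⊗_) (sym p)))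
  trans± : ∀ {L M N} → L ≈± M → M ≈± N → L ≈± N
  trans± (inj₁ p) (inj₁ q) = inj₁ (trans p q)
  trans± (inj₁ p) (inj₂ q) = inj₂ (trans p q)
  trans± (inj₂ p) (inj₁ q) = inj₂ (trans p (cong (-Id ⊗_) q))
  trans± {N = N} (inj₂ p) (inj₂ q) = inj₁ (trans p (trans (cong (-Id ⊗_) q) (-Id-involutive N)))

module ≈± = IsEquivalence ≈±-isEquivalence

⊗-cong± : ∀ {M M′ N N′} → M ≈± M′ → N ≈± N′ → M ⊗ N ≈± M′ ⊗ N′
⊗-cong± {M′ = M′} {N′ = N′} p q = ≈±.trans (left p) (right q)
  where
  left : ∀ {M N} → M ≈± M′ → M ⊗ N ≈± M′ ⊗ N
  left (inj₁ refl) = inj₁ refl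
  left {N = N} (inj₂ refl) = inj₂ (⊗-assoc -Id M′ N)
  right : ∀ {N} → N ≈± N′ → M′ ⊗ N ≈± M′ ⊗ N′
  right (inj₁ refl) = inj₁ refl
  right (inj₂ refl) = inj₂ (begin
    M′ ⊗ (-Id ⊗ N′)  ≡⟨ sym (⊗-assoc M′ -Id N′) ⟩
    (M′ ⊗ -Id) ⊗ N′  ≡⟨ cong (_⊗ N′) (-Id-central M′) ⟩
    (-Id ⊗ M′) ⊗ N′  ≡⟨ ⊗-assoc -Id M′ N′ ⟩
    -Id ⊗ (M′ ⊗ N′)  ∎)
    where open ≡-Reasoning

E : Z3 → Mat
E = elemM

E0 : Mat
E0 = E 0₃

Word : Set
Word = List Mat

-- ⟦ X₁ ∷ ⋯ ∷ Xₙ ∷ [] ⟧ = Xₙ ⊗ ⋯ ⊗ X₁, the order of M_n(a_1,…,a_n)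
⟦_⟧ : Word → Mat
⟦ [] ⟧ = Id
⟦ X ∷ w ⟧ = ⟦ w ⟧ ⊗ X

⟦⟧-++ : ∀ u v → ⟦ u ++ v ⟧ ≡ ⟦ v ⟧ ⊗ ⟦ u ⟧
⟦⟧-++ [] v = sym (⊗-identityʳ ⟦ v ⟧)
⟦⟧-++ (X ∷ u) v = trans (cong (_⊗ X) (⟦⟧-++ u v)) (⊗-assoc ⟦ v ⟧ ⟦ u ⟧ X)

infix 4 _≋_ _≋?_

-- A record rather than a synonym, so that unification never unfolds ⟦_⟧ into matrix arithmetic.
record _≋_ (u v : Word) : Set where
  constructor ≋⁺
  field ≋⁻ : ⟦ u ⟧ ≈± ⟦ v ⟧
open _≋_ public

_≋?_ : (u v : Word) → Dec (u ≋ v)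
u ≋? v = map′ ≋⁺ ≋⁻ (⟦ u ⟧ ≈±? ⟦ v ⟧)

≋-refl : ∀ {u} → u ≋ u
≋-refl = ≋⁺ ≈±.refl

≋-sym : ∀ {u v} → u ≋ v → v ≋ u
≋-sym (≋⁺ p) = ≋⁺ (≈±.sym p)

≋-trans : ∀ {u v w} → u ≋ v → v ≋ w → u ≋ w
≋-trans (≋⁺ p) (≋⁺ q) = ≋⁺ (≈±.trans p q)

≋-setoid : Setoid _ _
≋-setoid = record
  { Carrier = Word ; _≈_ = _≋_
  ; isEquivalence = record { refl = ≋-refl ; sym = ≋-sym ; trans = ≋-trans } }

≋-++ : ∀ {u u′ v v′} → u ≋ u′ → v ≋ v′ → u ++ v ≋ u′ ++ v′
≋-++ {u} {u′} {v} {v′} (≋⁺ p) (≋⁺ q) =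
  ≋⁺ (subst₂ _≈±_ (sym (⟦⟧-++ u v)) (sym (⟦⟧-++ u′ v′)) (⊗-cong± q p))

replace : ∀ u {v v′ w} → v ≋ v′ → u ++ v ++ w ≋ u ++ v′ ++ w
replace u p = ≋-++ (≋-refl {u}) (≋-++ p ≋-refl)

signWeight : Sign → Z3
signWeight plus = 1₃
signWeight minus = -₃ 1₃

E-split : ∀ a b → E (a +₃ b) ∷ [] ≋ E a ∷ E0 ∷ E b ∷ []
E-split = from-yes (all? λ a → all? λ b → E (a +₃ b) ∷ [] ≋? E a ∷ E0 ∷ E b ∷ [])

E-split′ : ∀ a b → E (a +₃ b) ∷ [] ≋ E b ∷ E0 ∷ E a ∷ []
E-split′ = from-yes (all? λ a → all? λ b → E (a +₃ b) ∷ [] ≋? E b ∷ E0 ∷ E a ∷ [])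

E0² : E0 ∷ E0 ∷ [] ≋ []
E0² = ≋⁺ (inj₂ refl)

triangle : ∀ s → let ε = E (signWeight s) in ε ∷ ε ∷ ε ∷ [] ≋ []
triangle plus = ≋⁺ (inj₂ refl)
triangle minus = ≋⁺ (inj₁ refl)

ear-core : ∀ s → let ε = signWeight s in
  E (-₃ ε) ∷ E0 ∷ E ε ∷ E ε ∷ E0 ∷ E (-₃ ε) ∷ [] ≋ []
ear-core plus = ≋⁺ (inj₂ refl)
ear-core minus = ≋⁺ (inj₂ refl)

E-not-closed : ∀ a → ¬ (E a ∷ [] ≋ [])
E-not-closed = from-yes (all? λ a → ¬? (E a ∷ [] ≋? []))

digon : ∀ a b → E a ∷ Id ∷ E b ∷ [] ≋ [] → a ≡ 0₃ × b ≡ 0₃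
digon = from-yes (all? λ a → all? λ b → (E a ∷ Id ∷ E b ∷ [] ≋? []) →-dec (a ≟₃ 0₃ ×-dec b ≟₃ 0₃))

module _ where
  open SetoidReasoning ≋-setoid

  strip-zeros : ∀ {X} → E0 ∷ X ∷ E0 ∷ [] ≋ [] → X ∷ [] ≋ []
  strip-zeros {X} h = begin
    X ∷ []                         ≈⟨ ≋-sym (≋-++ E0² (≋-++ (≋-refl {X ∷ []}) E0²)) ⟩
    E0 ∷ E0 ∷ X ∷ E0 ∷ E0 ∷ []     ≈⟨ replace (E0 ∷ []) h ⟩
    E0 ∷ E0 ∷ []                   ≈⟨ E0² ⟩
    []                             ∎

  -- E (c - ε) = ±E (-ε) E 0 E c; padding with the closed word ε ε ε then exposes the hypothesis.
  ear-first : ∀ s {b c X} → let ε = signWeight s in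
    E ε ∷ E c ∷ X ∷ E b ∷ [] ≋ [] → E (c -₃ ε) ∷ X ∷ E (b -₃ ε) ∷ [] ≋ []
  ear-first s {b} {c} {X} h = begin
    E (c -₃ ε) ∷ X ∷ E (b -₃ ε) ∷ []
      ≈⟨ ≋-++ (E-split′ c (-₃ ε)) (≋-++ (≋-refl {X ∷ []}) (E-split b (-₃ ε))) ⟩
    E (-₃ ε) ∷ E0 ∷ E c ∷ X ∷ E b ∷ E0 ∷ E (-₃ ε) ∷ []
      ≈⟨ replace (E (-₃ ε) ∷ E0 ∷ []) (≋-sym (triangle s)) ⟩
    E (-₃ ε) ∷ E0 ∷ E ε ∷ E ε ∷ E ε ∷ E c ∷ X ∷ E b ∷ E0 ∷ E (-₃ ε) ∷ []
      ≈⟨ replace (E (-₃ ε) ∷ E0 ∷ E ε ∷ E ε ∷ []) h ⟩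
    E (-₃ ε) ∷ E0 ∷ E ε ∷ E ε ∷ E0 ∷ E (-₃ ε) ∷ []
      ≈⟨ ear-core s ⟩
    []  ∎
    where ε = signWeight s

  ear-last : ∀ s {a c X} → let ε = signWeight s in
    E a ∷ X ∷ E c ∷ E ε ∷ [] ≋ [] → E (a -₃ ε) ∷ X ∷ E (c -₃ ε) ∷ [] ≋ []
  ear-last s {a} {c} {X} h = begin
    E (a -₃ ε) ∷ X ∷ E (c -₃ ε) ∷ []
      ≈⟨ ≋-++ (E-split′ a (-₃ ε)) (≋-++ (≋-refl {X ∷ []}) (E-split c (-₃ ε))) ⟩
    E (-₃ ε) ∷ E0 ∷ E a ∷ X ∷ E c ∷ E0 ∷ E (-₃ ε) ∷ []
      ≈⟨ replace (E (-₃ ε) ∷ E0 ∷ E a ∷ X ∷ E c ∷ []) (≋-sym (triangle s)) ⟩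
    E (-₃ ε) ∷ E0 ∷ E a ∷ X ∷ E c ∷ E ε ∷ E ε ∷ E ε ∷ E0 ∷ E (-₃ ε) ∷ []
      ≈⟨ replace (E (-₃ ε) ∷ E0 ∷ []) h ⟩
    E (-₃ ε) ∷ E0 ∷ E ε ∷ E ε ∷ E0 ∷ E (-₃ ε) ∷ []
      ≈⟨ ear-core s ⟩
    []  ∎
    where ε = signWeight s

  triangle-glue : ∀ s {a a′ b b′ X Y} → let ε = signWeight s in
    E a ∷ X ∷ E a′ ∷ [] ≋ [] → E b ∷ Y ∷ E b′ ∷ [] ≋ [] →
    E (ε +₃ a) ∷ X ∷ E (ε +₃ (a′ +₃ b)) ∷ Y ∷ E (ε +₃ b′) ∷ [] ≋ []
  triangle-glue s {a} {a′} {b} {b′} {X} {Y} hA hB = begin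
    E (ε +₃ a) ∷ X ∷ E (ε +₃ (a′ +₃ b)) ∷ Y ∷ E (ε +₃ b′) ∷ []
      ≈⟨ ≋-++ (E-split ε a) (≋-++ (≋-refl {X ∷ []})
           (≋-++ middle (≋-++ (≋-refl {Y ∷ []}) (E-split′ ε b′)))) ⟩
    E ε ∷ E0 ∷ E a ∷ X ∷ E a′ ∷ E0 ∷ E ε ∷ E0 ∷ E b ∷ Y ∷ E b′ ∷ E0 ∷ E ε ∷ []
      ≈⟨ replace (E ε ∷ E0 ∷ []) hA ⟩
    E ε ∷ E0 ∷ E0 ∷ E ε ∷ E0 ∷ E b ∷ Y ∷ E b′ ∷ E0 ∷ E ε ∷ []
      ≈⟨ replace (E ε ∷ E0 ∷ E0 ∷ E ε ∷ E0 ∷ []) hB ⟩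
    E ε ∷ E0 ∷ E0 ∷ E ε ∷ E0 ∷ E0 ∷ E ε ∷ []
      ≈⟨ replace (E ε ∷ []) E0² ⟩
    E ε ∷ E ε ∷ E0 ∷ E0 ∷ E ε ∷ []
      ≈⟨ replace (E ε ∷ E ε ∷ []) E0² ⟩
    E ε ∷ E ε ∷ E ε ∷ []
      ≈⟨ triangle s ⟩
    []  ∎
    where
    ε = signWeight s
    middle : E (ε +₃ (a′ +₃ b)) ∷ [] ≋ E a′ ∷ E0 ∷ E ε ∷ E0 ∷ E b ∷ []
    middle rewrite +₃-leftComm ε a′ b = ≋-trans (E-split a′ (ε +₃ b)) (replace (E a′ ∷ E0 ∷ []) (E-split ε b))

  quadrilateral-glue : ∀ {a a′ b b′ c c′ X Y Z} →
    E a ∷ X ∷ E a′ ∷ [] ≋ [] → E b ∷ Y ∷ E b′ ∷ [] ≋ [] → E c ∷ Z ∷ E c′ ∷ [] ≋ [] →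
    E a ∷ X ∷ E (a′ +₃ b) ∷ Y ∷ E (b′ +₃ c) ∷ Z ∷ E c′ ∷ [] ≋ []
  quadrilateral-glue {a} {a′} {b} {b′} {c} {c′} {X} {Y} {Z} hA hB hC = begin
    E a ∷ X ∷ E (a′ +₃ b) ∷ Y ∷ E (b′ +₃ c) ∷ Z ∷ E c′ ∷ []
      ≈⟨ replace (E a ∷ X ∷ []) (E-split a′ b) ⟩
    E a ∷ X ∷ E a′ ∷ E0 ∷ E b ∷ Y ∷ E (b′ +₃ c) ∷ Z ∷ E c′ ∷ []
      ≈⟨ replace (E a ∷ X ∷ E a′ ∷ E0 ∷ E b ∷ Y ∷ []) (E-split b′ c) ⟩
    E a ∷ X ∷ E a′ ∷ E0 ∷ E b ∷ Y ∷ E b′ ∷ E0 ∷ E c ∷ Z ∷ E c′ ∷ []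
      ≈⟨ replace [] hA ⟩
    E0 ∷ E b ∷ Y ∷ E b′ ∷ E0 ∷ E c ∷ Z ∷ E c′ ∷ []
      ≈⟨ replace (E0 ∷ []) hB ⟩
    E0 ∷ E0 ∷ E c ∷ Z ∷ E c′ ∷ []
      ≈⟨ replace (E0 ∷ E0 ∷ []) hC ⟩
    E0 ∷ E0 ∷ []
      ≈⟨ E0² ⟩
    []  ∎

-- Π c i j = E (c (j-1)) ⊗ ⋯ ⊗ E (c i), and Id when j ≤ i
Π : (ℕ → Z3) → ℕ → ℕ → Mat
Π c i zero = Id
Π c i (suc j) = if does (i ≤? j) then E (c j) ⊗ Π c i j else Id

Π-empty : ∀ c {i j} → j ≤ i → Π c i j ≡ Id
Π-empty c {j = zero} _ = refl
Π-empty c {i} {suc j} j<i rewrite dec-false (i ≤? j) (<⇒≱ j<i) = refl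

Π-last : ∀ c {i j} → i ≤ j → Π c i (suc j) ≡ E (c j) ⊗ Π c i j
Π-last c {i} {j} i≤j rewrite dec-true (i ≤? j) i≤j = refl

Π-split : ∀ c {i k j} → i ≤ k → k ≤ j → Π c i j ≡ Π c k j ⊗ Π c i k
Π-split c {i} {k} i≤k k≤j with m≤n⇒m<n∨m≡n k≤j
... | inj₂ refl = sym (trans (cong (_⊗ Π c i k) (Π-empty c {k} ≤-refl)) (⊗-identityˡ (Π c i k)))
... | inj₁ (s≤s {n = j} k≤j′) = begin
  Π c i (suc j)                   ≡⟨ Π-last c (≤-trans i≤k k≤j′) ⟩
  E (c j) ⊗ Π c i j               ≡⟨ cong (E (c j) ⊗_) (Π-split c i≤k k≤j′) ⟩
  E (c j) ⊗ (Π c k j ⊗ Π c i k)   ≡⟨ sym (⊗-assoc (E (c j)) (Π c k j) (Π c i k)) ⟩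
  (E (c j) ⊗ Π c k j) ⊗ Π c i k   ≡⟨ cong (_⊗ Π c i k) (sym (Π-last c k≤j′)) ⟩
  Π c k (suc j) ⊗ Π c i k         ∎
  where open ≡-Reasoning

Π-single : ∀ c i → Π c i (suc i) ≡ E (c i)
Π-single c i = trans (Π-last c {i} ≤-refl) (trans (cong (E (c i) ⊗_) (Π-empty c {i} ≤-refl)) (⊗-identityʳ (E (c i))))

Π-first : ∀ c {i j} → i < j → Π c i j ≡ Π c (suc i) j ⊗ E (c i)
Π-first c {i} {j} i<j = trans (Π-split c (n≤1+n i) i<j) (cong (Π c (suc i) j ⊗_) (Π-single c i))

Π-cong : ∀ {c c′ i} j → (∀ x → i ≤ x → x < j → c x ≡ c′ x) → Π c i j ≡ Π c′ i j
Π-cong zero _ = refl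
Π-cong {c} {c′} {i} (suc j) h with i ≤? j
... | yes i≤j = begin
  Π c i (suc j)        ≡⟨ Π-last c i≤j ⟩
  E (c j) ⊗ Π c i j    ≡⟨ cong₂ _⊗_ (cong E (h j i≤j (n<1+n j))) (Π-cong j (λ x i≤x x<j → h x i≤x (m<n⇒m<1+n x<j))) ⟩
  E (c′ j) ⊗ Π c′ i j  ≡⟨ sym (Π-last c′ i≤j) ⟩
  Π c′ i (suc j)       ∎
  where open ≡-Reasoning
... | no i≰j = trans (Π-empty c (≰⇒> i≰j)) (sym (Π-empty c′ (≰⇒> i≰j)))

-- the word E (c i), E (c (i+1)), …, E (c j) of the polygon i, …, j, its interior as one letter
frame : (ℕ → Z3) → ℕ → ℕ → Word
frame c i j = E (c i) ∷ Π c (suc i) j ∷ E (c j) ∷ []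

≡⇒≋ : ∀ {u v} → ⟦ u ⟧ ≡ ⟦ v ⟧ → u ≋ v
≡⇒≋ p = ≋⁺ (inj₁ p)

⟦⟧-single : ∀ X → ⟦ X ∷ [] ⟧ ≡ X
⟦⟧-single = ⊗-identityˡ

⟦⟧-pair : ∀ X Y → ⟦ X ∷ Y ∷ [] ⟧ ≡ Y ⊗ X
⟦⟧-pair X Y = cong (_⊗ X) (⊗-identityˡ Y)

Π-first≋ : ∀ c {i j} → i < j → Π c i j ∷ [] ≋ E (c i) ∷ Π c (suc i) j ∷ []
Π-first≋ c {i} {j} i<j =
  ≡⇒≋ (trans (⟦⟧-single (Π c i j)) (trans (Π-first c i<j) (sym (⟦⟧-pair (E (c i)) (Π c (suc i) j)))))

Π-last≋ : ∀ c {i j} → i ≤ j → Π c i (suc j) ∷ [] ≋ Π c i j ∷ E (c j) ∷ []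
Π-last≋ c {i} {j} i≤j =
  ≡⇒≋ (trans (⟦⟧-single (Π c i (suc j))) (trans (Π-last c i≤j) (sym (⟦⟧-pair (Π c i j) (E (c j))))))

Π-split≋ : ∀ c {i k j} → i ≤ k → k ≤ j → Π c i j ∷ [] ≋ Π c i k ∷ Π c k j ∷ []
Π-split≋ c {i} {k} {j} i≤k k≤j =
  ≡⇒≋ (trans (⟦⟧-single (Π c i j)) (trans (Π-split c i≤k k≤j) (sym (⟦⟧-pair (Π c i k) (Π c k j)))))

Π-around : ∀ c {i k j} → i < k → k < j →
  Π c (suc i) j ∷ [] ≋ Π c (suc i) k ∷ E (c k) ∷ Π c (suc k) j ∷ []
Π-around c {i} {k} i<k k<j =
  ≋-trans (Π-split≋ c i<k (<⇒≤ k<j)) (replace (Π c (suc i) k ∷ []) (Π-first≋ c k<j))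

Π≋frame : ∀ c {i j} → i < j → Π c i (suc j) ∷ [] ≋ frame c i j
Π≋frame c i<j = ≋-trans (Π-last≋ c (<⇒≤ i<j)) (replace [] (Π-first≋ c i<j))

foldl-tabulate : ∀ {n} (f : Fin n → Z3) c k M → (∀ t → f t ≡ c (toℕ t + k)) →
  foldl (λ M a → elemM a ⊗ M) M (toList (tabulate f)) ≡ Π c k (n + k) ⊗ M
foldl-tabulate {zero} f c k M _ = sym (trans (cong (_⊗ M) (Π-empty c {k} ≤-refl)) (⊗-identityˡ M))
foldl-tabulate {suc n} f c k M h = begin
  foldl step (E (f zero) ⊗ M) (toList (tabulate (f ∘ suc)))
    ≡⟨ foldl-tabulate (f ∘ suc) c (suc k) (E (f zero) ⊗ M) (λ t → trans (h (suc t)) (cong c (sym (+-suc (toℕ t) k)))) ⟩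
  Π c (suc k) (n + suc k) ⊗ (E (f zero) ⊗ M)
    ≡⟨ cong₂ (λ m a → Π c (suc k) m ⊗ (E a ⊗ M)) (+-suc n k) (h zero) ⟩
  Π c (suc k) (suc n + k) ⊗ (E (c k) ⊗ M)
    ≡⟨ sym (⊗-assoc (Π c (suc k) (suc n + k)) (E (c k)) M) ⟩
  (Π c (suc k) (suc n + k) ⊗ E (c k)) ⊗ M
    ≡⟨ cong (_⊗ M) (sym (Π-first c (s≤s (m≤n+m k n)))) ⟩
  Π c k (suc n + k) ⊗ M  ∎
  where
  open ≡-Reasoning
  step = λ M a → elemM a ⊗ M

Mn-tabulate : ∀ n c → Mn (tabulate {n = n} (λ t → c (suc (toℕ t)))) ≡ Π c 1 (suc n)
Mn-tabulate n c =
  trans (foldl-tabulate {n} _ c 1 Id (λ t → cong c (+-comm 1 (toℕ t))))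
        (trans (⊗-identityʳ (Π c 1 (n + 1))) (cong (Π c 1) (+-comm n 1)))

single-closed : ∀ {X} → X ≈± Id → X ∷ [] ≋ []
single-closed {X} = ≋⁺ ∘ subst (_≈± Id) (sym (⟦⟧-single X))

single-closed⁻¹ : ∀ {X} → X ∷ [] ≋ [] → X ≈± Id
single-closed⁻¹ {X} = subst (_≈± Id) (⟦⟧-single X) ∘ ≋⁻

solution⇒closed : ∀ n c → 1 < n → IsSolutionE3 (tabulate {n = n} (λ t → c (suc (toℕ t)))) → frame c 1 n ≋ []
solution⇒closed n c 1<n sol =
  ≋-trans (≋-sym (Π≋frame c 1<n)) (single-closed (subst (_≈± Id) (Mn-tabulate n c) sol))

closed⇒solution : ∀ n c → 1 < n → frame c 1 n ≋ [] → IsSolutionE3 (tabulate {n = n} (λ t → c (suc (toℕ t))))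
closed⇒solution n c 1<n h =
  subst (_≈± Id) (sym (Mn-tabulate n c)) (single-closed⁻¹ (≋-trans (Π≋frame c 1<n) h))

contribution : ℕ → Cell → Z3
contribution x C = if hasVertex x C then weight C else 0₃

quiddityAt-++ : ∀ A B x → quiddityAt (A ++ B) x ≡ quiddityAt A x +₃ quiddityAt B x
quiddityAt-++ [] B x = sym (+₃-identityˡ (quiddityAt B x))
quiddityAt-++ (C ∷ A) B x =
  trans (cong (contribution x C +₃_) (quiddityAt-++ A B x))
        (sym (+₃-assoc (contribution x C) (quiddityAt A x) (quiddityAt B x)))

contribution-quad : ∀ x i k l j → contribution x (quad i k l j) ≡ 0₃
contribution-quad x i k l j with hasVertex x (quad i k l j)
... | true = refl
... | false = refl

weight-tri : ∀ {i k j} s → weight (tri i k j s) ≡ signWeight s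
weight-tri plus = refl
weight-tri minus = refl

hasVertex-tri : ∀ {x} i k j s → x ≡ i ⊎ x ≡ k ⊎ x ≡ j → hasVertex x (tri i k j s) ≡ true
hasVertex-tri {x} i k j s (inj₁ x≡i) rewrite dec-true (x ≟ i) x≡i = refl
hasVertex-tri {x} i k j s (inj₂ (inj₁ x≡k)) rewrite dec-true (x ≟ k) x≡k = ∨-zeroʳ (x =ᵇ i)
hasVertex-tri {x} i k j s (inj₂ (inj₂ x≡j))
  rewrite dec-true (x ≟ j) x≡j | ∨-zeroʳ (x =ᵇ k) = ∨-zeroʳ (x =ᵇ i)

contribution-tri-vertex : ∀ {x} i k j s → x ≡ i ⊎ x ≡ k ⊎ x ≡ j → contribution x (tri i k j s) ≡ signWeight s
contribution-tri-vertex i k j s x∈T rewrite hasVertex-tri i k j s x∈T = weight-tri s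

contribution-tri-other : ∀ {x} i k j s → x ≢ i → x ≢ k → x ≢ j → contribution x (tri i k j s) ≡ 0₃
contribution-tri-other {x} i k j s x≢i x≢k x≢j
  rewrite dec-false (x ≟ i) x≢i | dec-false (x ≟ k) x≢k | dec-false (x ≟ j) x≢j = refl

outside-≢ : ∀ {i j x y} → x < i ⊎ j < x → i ≤ y → y ≤ j → x ≢ y
outside-≢ (inj₁ x<i) i≤y _ refl = <-irrefl refl (<-≤-trans x<i i≤y)
outside-≢ (inj₂ j<x) _ y≤j refl = <-irrefl refl (≤-<-trans y≤j j<x)

outside-shrink : ∀ {i j i′ j′ x} → i ≤ i′ → j′ ≤ j → x < i ⊎ j < x → x < i′ ⊎ j′ < x
outside-shrink i≤i′ j′≤j = Sum.map (λ x<i → <-≤-trans x<i i≤i′) (≤-<-trans j′≤j)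

quiddity-outside : ∀ {i j A x} → Dissects i j A → x < i ⊎ j < x → quiddityAt A x ≡ 0₃
quiddity-outside edge _ = refl
quiddity-outside {x = x} (tri {i = i} {k} {j} {A} {B} s i<k k<j DA DB) out =
  cong₂ _+₃_ (contribution-tri-other i k j s (outside-≢ out ≤-refl i≤j) (outside-≢ out (<⇒≤ i<k) (<⇒≤ k<j))
                                        (outside-≢ out i≤j ≤-refl))
             (trans (quiddityAt-++ A B x)
                    (cong₂ _+₃_ (quiddity-outside DA (outside-shrink ≤-refl (<⇒≤ k<j) out))
                                (quiddity-outside DB (outside-shrink (<⇒≤ i<k) ≤-refl out))))
  where i≤j = <⇒≤ (<-trans i<k k<j)
quiddity-outside {x = x} (quad {i = i} {k} {l} {j} {A} {B} {C} i<k k<l l<j DA DB DC) out =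
  cong₂ _+₃_ (contribution-quad x i k l j)
    (trans (quiddityAt-++ A (B ++ C) x) (cong₂ _+₃_
      (quiddity-outside DA (outside-shrink ≤-refl (<⇒≤ (<-trans k<l l<j)) out))
      (trans (quiddityAt-++ B C x) (cong₂ _+₃_
        (quiddity-outside DB (outside-shrink (<⇒≤ i<k) (<⇒≤ l<j) out))
        (quiddity-outside DC (outside-shrink (<⇒≤ (<-trans i<k k<l)) ≤-refl out))))))

module _ where
  open SetoidReasoning ≋-setoid

  closed-edge : ∀ i → frame (quiddityAt []) i (suc i) ≋ []
  closed-edge i = begin
    E0 ∷ Π (λ _ → 0₃) (suc i) (suc i) ∷ E0 ∷ []
      ≈⟨ replace (E0 ∷ []) (single-closed (inj₁ (Π-empty _ {suc i} ≤-refl))) ⟩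
    E0 ∷ E0 ∷ []
      ≈⟨ E0² ⟩
    []  ∎

  closed-tri : ∀ {i k j A B} s → i < k → k < j → Dissects i k A → Dissects k j B →
    frame (quiddityAt A) i k ≋ [] → frame (quiddityAt B) k j ≋ [] →
    frame (quiddityAt (tri i k j s ∷ A ++ B)) i j ≋ []
  closed-tri {i} {k} {j} {A} {B} s i<k k<j DA DB hA hB = begin
    frame Q i j
      ≈⟨ replace (E (Q i) ∷ []) (Π-around Q i<k k<j) ⟩
    E (Q i) ∷ Π Q (suc i) k ∷ E (Q k) ∷ Π Q (suc k) j ∷ E (Q j) ∷ []
      ≡⟨ Pointwise-≡⇒≡ (cong E Qi ∷ ΠA ∷ cong E Qk ∷ ΠB ∷ cong E Qj ∷ []) ⟩
    E (ε +₃ qA i) ∷ Π qA (suc i) k ∷ E (ε +₃ (qA k +₃ qB k)) ∷ Π qB (suc k) j ∷ E (ε +₃ qB j) ∷ []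
      ≈⟨ triangle-glue s hA hB ⟩
    []  ∎
    where
    T = tri i k j s
    Q = quiddityAt (T ∷ A ++ B)
    qA = quiddityAt A
    qB = quiddityAt B
    ε = signWeight s
    Q≡ : ∀ x → Q x ≡ contribution x T +₃ (qA x +₃ qB x)
    Q≡ x = cong (contribution x T +₃_) (quiddityAt-++ A B x)
    onA : ∀ x → x < k → Q x ≡ contribution x T +₃ qA x
    onA x x<k = trans (Q≡ x) (cong (contribution x T +₃_)
      (trans (cong (qA x +₃_) (quiddity-outside DB (inj₁ x<k))) (+₃-identityʳ (qA x))))
    onB : ∀ x → k < x → Q x ≡ contribution x T +₃ qB x
    onB x k<x = trans (Q≡ x) (cong (contribution x T +₃_)
      (trans (cong (_+₃ qB x) (quiddity-outside DA (inj₂ k<x))) (+₃-identityˡ (qB x))))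
    Qi : Q i ≡ ε +₃ qA i
    Qi = trans (onA i i<k) (cong (_+₃ qA i) (contribution-tri-vertex i k j s (inj₁ refl)))
    Qk : Q k ≡ ε +₃ (qA k +₃ qB k)
    Qk = trans (Q≡ k) (cong (_+₃ (qA k +₃ qB k)) (contribution-tri-vertex i k j s (inj₂ (inj₁ refl))))
    Qj : Q j ≡ ε +₃ qB j
    Qj = trans (onB j k<j) (cong (_+₃ qB j) (contribution-tri-vertex i k j s (inj₂ (inj₂ refl))))
    ΠA : Π Q (suc i) k ≡ Π qA (suc i) k
    ΠA = Π-cong k λ x i<x x<k → trans (onA x x<k) (trans (cong (_+₃ qA x)
      (contribution-tri-other i k j s (≢-sym (<⇒≢ i<x)) (<⇒≢ x<k) (<⇒≢ (<-trans x<k k<j))))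
      (+₃-identityˡ (qA x)))
    ΠB : Π Q (suc k) j ≡ Π qB (suc k) j
    ΠB = Π-cong j λ x k<x x<j → trans (onB x k<x) (trans (cong (_+₃ qB x)
      (contribution-tri-other i k j s (≢-sym (<⇒≢ (<-trans i<k k<x))) (≢-sym (<⇒≢ k<x)) (<⇒≢ x<j)))
      (+₃-identityˡ (qB x)))

  closed-quad : ∀ {i k l j A B C} → i < k → k < l → l < j →
    Dissects i k A → Dissects k l B → Dissects l j C →
    frame (quiddityAt A) i k ≋ [] → frame (quiddityAt B) k l ≋ [] → frame (quiddityAt C) l j ≋ [] →
    frame (quiddityAt (quad i k l j ∷ A ++ B ++ C)) i j ≋ []
  closed-quad {i} {k} {l} {j} {A} {B} {C} i<k k<l l<j DA DB DC hA hB hC = begin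
    frame Q i j
      ≈⟨ replace (E (Q i) ∷ []) (Π-around Q i<k (<-trans k<l l<j)) ⟩
    E (Q i) ∷ Π Q (suc i) k ∷ E (Q k) ∷ Π Q (suc k) j ∷ E (Q j) ∷ []
      ≈⟨ replace (E (Q i) ∷ Π Q (suc i) k ∷ E (Q k) ∷ []) (Π-around Q k<l l<j) ⟩
    E (Q i) ∷ Π Q (suc i) k ∷ E (Q k) ∷ Π Q (suc k) l ∷ E (Q l) ∷ Π Q (suc l) j ∷ E (Q j) ∷ []
      ≡⟨ Pointwise-≡⇒≡ (cong E Qi ∷ ΠA ∷ cong E Qk ∷ ΠB ∷ cong E Ql ∷ ΠC ∷ cong E Qj ∷ []) ⟩
    E (qA i) ∷ Π qA (suc i) k ∷ E (qA k +₃ qB k) ∷ Π qB (suc k) l ∷ E (qB l +₃ qC l) ∷ Π qC (suc l) j ∷ E (qC j) ∷ []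
      ≈⟨ quadrilateral-glue hA hB hC ⟩
    []  ∎
    where
    Q = quiddityAt (quad i k l j ∷ A ++ B ++ C)
    qA = quiddityAt A
    qB = quiddityAt B
    qC = quiddityAt C
    Q≡ : ∀ x → Q x ≡ qA x +₃ (qB x +₃ qC x)
    Q≡ x = trans (cong₂ _+₃_ (contribution-quad x i k l j)
                   (trans (quiddityAt-++ A (B ++ C) x) (cong (qA x +₃_) (quiddityAt-++ B C x))))
                 (+₃-identityˡ _)
    A0 : ∀ {x} → k < x → qA x ≡ 0₃
    A0 k<x = quiddity-outside DA (inj₂ k<x)
    B0 : ∀ {x} → x < k ⊎ l < x → qB x ≡ 0₃
    B0 = quiddity-outside DB
    C0 : ∀ {x} → x < l → qC x ≡ 0₃
    C0 x<l = quiddity-outside DC (inj₁ x<l)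
    onA : ∀ x → x < k → Q x ≡ qA x
    onA x x<k = trans (Q≡ x) (trans (cong₂ (λ b c → qA x +₃ (b +₃ c)) (B0 (inj₁ x<k)) (C0 (<-trans x<k k<l)))
                                    (+₃-identityʳ (qA x)))
    onC : ∀ x → l < x → Q x ≡ qC x
    onC x l<x = trans (Q≡ x) (trans (cong₂ (λ a b → a +₃ (b +₃ qC x)) (A0 (<-trans k<l l<x)) (B0 (inj₂ l<x)))
                                    (trans (+₃-identityˡ _) (+₃-identityˡ (qC x))))
    Qi : Q i ≡ qA i
    Qi = onA i i<k
    Qk : Q k ≡ qA k +₃ qB k
    Qk = trans (Q≡ k) (trans (cong (λ c → qA k +₃ (qB k +₃ c)) (C0 k<l))
                             (cong (qA k +₃_) (+₃-identityʳ (qB k))))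
    Ql : Q l ≡ qB l +₃ qC l
    Ql = trans (Q≡ l) (trans (cong (_+₃ (qB l +₃ qC l)) (A0 k<l)) (+₃-identityˡ _))
    Qj : Q j ≡ qC j
    Qj = onC j l<j
    ΠA : Π Q (suc i) k ≡ Π qA (suc i) k
    ΠA = Π-cong k λ x _ x<k → onA x x<k
    ΠB : Π Q (suc k) l ≡ Π qB (suc k) l
    ΠB = Π-cong l λ x k<x x<l →
      trans (Q≡ x) (trans (cong₂ (λ a c → a +₃ (qB x +₃ c)) (A0 k<x) (C0 x<l))
                          (trans (+₃-identityˡ _) (+₃-identityʳ (qB x))))
    ΠC : Π Q (suc l) j ≡ Π qC (suc l) j
    ΠC = Π-cong j λ x l<x _ → onC x l<x

closed : ∀ {i j A} → Dissects i j A → frame (quiddityAt A) i j ≋ []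
closed {i} edge = closed-edge i
closed (tri s i<k k<j DA DB) = closed-tri s i<k k<j DA DB (closed DA) (closed DB)
closed (quad i<k k<l l<j DA DB DC) = closed-quad i<k k<l l<j DA DB DC (closed DA) (closed DB) (closed DC)

QuiddityDissection : (ℕ → Z3) → ℕ → ℕ → Set
QuiddityDissection c i j =
  Σ (List Cell) λ A → Dissects i j A × (∀ x → i ≤ x → x ≤ j → quiddityAt A x ≡ c x)

nonzero-sign : ∀ {a} → a ≢ 0₃ → Σ Sign λ s → a ≡ signWeight s
nonzero-sign {zero} a≢0 = ⊥-elim (a≢0 refl)
nonzero-sign {suc zero} _ = plus , refl
nonzero-sign {suc (suc zero)} _ = minus , refl

infixl 6 _⊖_
_⊖_ : (ℕ → Z3) → Cell → ℕ → Z3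
(c ⊖ C) x = c x -₃ contribution x C

firstEar lastEar : ℕ → ℕ → Sign → Cell
firstEar n i s = tri i (suc i) (suc (suc n) + i) s
lastEar n i s = tri i (suc n + i) (suc (suc n) + i) s

digon-step : ∀ {i} c → frame c i (suc i) ≋ [] → QuiddityDissection c i (suc i)
digon-step {i} c h = [] , edge , agrees
  where
  ends : c i ≡ 0₃ × c (suc i) ≡ 0₃
  ends = digon (c i) (c (suc i)) (subst (λ X → E (c i) ∷ X ∷ E (c (suc i)) ∷ [] ≋ []) (Π-empty c {suc i} ≤-refl) h)
  agrees : ∀ x → i ≤ x → x ≤ suc i → 0₃ ≡ c x
  agrees x i≤x x≤1+i with m≤n⇒m<n∨m≡n x≤1+i
  ... | inj₂ refl = sym (proj₂ ends)
  ... | inj₁ x<1+i with ≤-antisym i≤x (≤-pred x<1+i)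
  ...   | refl = sym (proj₁ ends)

module _ where
  open SetoidReasoning ≋-setoid

  cut-first-ear : ∀ n {i} c s → c i ≡ signWeight s → frame c i (suc (suc n) + i) ≋ [] →
    frame (c ⊖ firstEar n i s) (suc i) (suc (suc n) + i) ≋ []
  cut-first-ear n {i} c s ci≡ε h = begin
    frame c′ (suc i) j
      ≡⟨ Pointwise-≡⇒≡ (cong E c′-next ∷ c′-inner ∷ cong E c′-last ∷ []) ⟩
    E (c (suc i) -₃ ε) ∷ Π c (suc (suc i)) j ∷ E (c j -₃ ε) ∷ []
      ≈⟨ ear-first s h′ ⟩
    []  ∎
    where
    j = suc (suc n) + i
    ε = signWeight s
    T = firstEar n i s
    c′ = c ⊖ T
    h′ : E ε ∷ E (c (suc i)) ∷ Π c (suc (suc i)) j ∷ E (c j) ∷ [] ≋ []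
    h′ = begin
      E ε ∷ E (c (suc i)) ∷ Π c (suc (suc i)) j ∷ E (c j) ∷ []
        ≡⟨ cong (λ a → E a ∷ E (c (suc i)) ∷ Π c (suc (suc i)) j ∷ E (c j) ∷ []) (sym ci≡ε) ⟩
      E (c i) ∷ E (c (suc i)) ∷ Π c (suc (suc i)) j ∷ E (c j) ∷ []
        ≈⟨ replace (E (c i) ∷ []) (≋-sym (Π-first≋ c (s≤s (s≤s (m≤n+m i n))))) ⟩
      frame c i j
        ≈⟨ h ⟩
      []  ∎
    c′-next : c′ (suc i) ≡ c (suc i) -₃ ε
    c′-next = cong (λ a → c (suc i) -₃ a) (contribution-tri-vertex i (suc i) j s (inj₂ (inj₁ refl)))
    c′-last : c′ j ≡ c j -₃ ε
    c′-last = cong (λ a → c j -₃ a) (contribution-tri-vertex i (suc i) j s (inj₂ (inj₂ refl)))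
    c′-inner : Π c′ (suc (suc i)) j ≡ Π c (suc (suc i)) j
    c′-inner = Π-cong j λ x 2+i≤x x<j →
      trans (cong (λ a → c x -₃ a) (contribution-tri-other i (suc i) j s
              (≢-sym (<⇒≢ (<-trans (n<1+n i) 2+i≤x))) (≢-sym (<⇒≢ 2+i≤x)) (<⇒≢ x<j)))
            (+₃-identityʳ (c x))

  cut-last-ear : ∀ n {i} c s → c (suc (suc n) + i) ≡ signWeight s → frame c i (suc (suc n) + i) ≋ [] →
    frame (c ⊖ lastEar n i s) i (suc n + i) ≋ []
  cut-last-ear n {i} c s cj≡ε h = begin
    frame c′ i j′
      ≡⟨ Pointwise-≡⇒≡ (cong E c′-first ∷ c′-inner ∷ cong E c′-prev ∷ []) ⟩
    E (c i -₃ ε) ∷ Π c (suc i) j′ ∷ E (c j′ -₃ ε) ∷ []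
      ≈⟨ ear-last s h′ ⟩
    []  ∎
    where
    j′ = suc n + i
    j = suc j′
    ε = signWeight s
    T = lastEar n i s
    c′ = c ⊖ T
    h′ : E (c i) ∷ Π c (suc i) j′ ∷ E (c j′) ∷ E ε ∷ [] ≋ []
    h′ = begin
      E (c i) ∷ Π c (suc i) j′ ∷ E (c j′) ∷ E ε ∷ []
        ≡⟨ cong (λ a → E (c i) ∷ Π c (suc i) j′ ∷ E (c j′) ∷ E a ∷ []) (sym cj≡ε) ⟩
      E (c i) ∷ Π c (suc i) j′ ∷ E (c j′) ∷ E (c j) ∷ []
        ≈⟨ replace (E (c i) ∷ []) (≋-sym (Π-last≋ c (s≤s (m≤n+m i n)))) ⟩
      frame c i j
        ≈⟨ h ⟩
      []  ∎
    c′-first : c′ i ≡ c i -₃ ε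
    c′-first = cong (λ a → c i -₃ a) (contribution-tri-vertex i j′ j s (inj₁ refl))
    c′-prev : c′ j′ ≡ c j′ -₃ ε
    c′-prev = cong (λ a → c j′ -₃ a) (contribution-tri-vertex i j′ j s (inj₂ (inj₁ refl)))
    c′-inner : Π c′ (suc i) j′ ≡ Π c (suc i) j′
    c′-inner = Π-cong j′ λ x 1+i≤x x<j′ →
      trans (cong (λ a → c x -₃ a) (contribution-tri-other i j′ j s
              (≢-sym (<⇒≢ 1+i≤x)) (<⇒≢ x<j′) (<⇒≢ (<-trans x<j′ (n<1+n j′)))))
            (+₃-identityʳ (c x))

  zero-ends : ∀ {i j} c → c i ≡ 0₃ → c j ≡ 0₃ → frame c i j ≋ [] → Π c (suc i) j ∷ [] ≋ []
  zero-ends {i} {j} c ci≡0 cj≡0 h = strip-zeros (subst₂ (λ a b → E a ∷ Π c (suc i) j ∷ E b ∷ [] ≋ []) ci≡0 cj≡0 h)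

  no-zero-ended-triangle : ∀ {i} c → c i ≡ 0₃ → c (suc (suc i)) ≡ 0₃ → ¬ (frame c i (suc (suc i)) ≋ [])
  no-zero-ended-triangle {i} c ci≡0 cj≡0 h =
    E-not-closed (c (suc i)) (subst (λ X → X ∷ [] ≋ []) (Π-single c (suc i)) (zero-ends c ci≡0 cj≡0 h))

  cut-quadrilateral : ∀ m {i} c → c i ≡ 0₃ → c (suc (suc (suc m)) + i) ≡ 0₃ →
    frame c i (suc (suc (suc m)) + i) ≋ [] → frame c (suc i) (suc (suc m) + i) ≋ []
  cut-quadrilateral m {i} c ci≡0 cj≡0 h =
    ≋-trans (≋-sym (Π≋frame c (s≤s (s≤s (m≤n+m i m))))) (zero-ends c ci≡0 cj≡0 h)

attach-first-ear : ∀ n {i} c s → c i ≡ signWeight s →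
  QuiddityDissection (c ⊖ firstEar n i s) (suc i) (suc (suc n) + i) → QuiddityDissection c i (suc (suc n) + i)
attach-first-ear n {i} c s ci≡ε (B , DB , B-agrees) =
  T ∷ B , tri s (n<1+n i) (s≤s (s≤s (m≤n+m i n))) edge DB , agrees
  where
  j = suc (suc n) + i
  T = firstEar n i s
  agrees : ∀ x → i ≤ x → x ≤ j → contribution x T +₃ quiddityAt B x ≡ c x
  agrees x i≤x x≤j = by-position (m≤n⇒m<n∨m≡n i≤x)
    where
    by-position : i < x ⊎ i ≡ x → contribution x T +₃ quiddityAt B x ≡ c x
    by-position (inj₁ i<x) = trans (cong (contribution x T +₃_) (B-agrees x i<x x≤j))
                                   (a+[b-a]≡b (contribution x T) (c x))
    by-position (inj₂ refl) = trans (cong₂ _+₃_ (contribution-tri-vertex i (suc i) j s (inj₁ refl))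
                                               (quiddity-outside DB (inj₁ (n<1+n i))))
                                    (trans (+₃-identityʳ (signWeight s)) (sym ci≡ε))

attach-last-ear : ∀ n {i} c s → c (suc (suc n) + i) ≡ signWeight s →
  QuiddityDissection (c ⊖ lastEar n i s) i (suc n + i) → QuiddityDissection c i (suc (suc n) + i)
attach-last-ear n {i} c s cj≡ε (A , DA , A-agrees) =
  T ∷ A ++ [] , tri s (s≤s (m≤n+m i n)) (n<1+n j′) DA edge , agrees
  where
  j′ = suc n + i
  j = suc j′
  T = lastEar n i s
  agrees : ∀ x → i ≤ x → x ≤ j → contribution x T +₃ quiddityAt (A ++ []) x ≡ c x
  agrees x i≤x x≤j =
    trans (cong (contribution x T +₃_) (trans (quiddityAt-++ A [] x) (+₃-identityʳ (quiddityAt A x))))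
          (by-position (m≤n⇒m<n∨m≡n x≤j))
    where
    by-position : x < j ⊎ x ≡ j → contribution x T +₃ quiddityAt A x ≡ c x
    by-position (inj₁ (s≤s x≤j′)) = trans (cong (contribution x T +₃_) (A-agrees x i≤x x≤j′))
                                          (a+[b-a]≡b (contribution x T) (c x))
    by-position (inj₂ refl) = trans (cong₂ _+₃_ (contribution-tri-vertex i j′ j s (inj₂ (inj₂ refl)))
                                               (quiddity-outside DA (inj₂ (n<1+n j′))))
                                    (trans (+₃-identityʳ (signWeight s)) (sym cj≡ε))

attach-quadrilateral : ∀ m {i} c → c i ≡ 0₃ → c (suc (suc (suc m)) + i) ≡ 0₃ →
  QuiddityDissection c (suc i) (suc (suc m) + i) → QuiddityDissection c i (suc (suc (suc m)) + i)
attach-quadrilateral m {i} c ci≡0 cj≡0 (B , DB , B-agrees) =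
  Q ∷ B ++ [] , quad (n<1+n i) (s≤s (s≤s (m≤n+m i m))) (n<1+n j′) edge DB edge , agrees
  where
  j′ = suc (suc m) + i
  j = suc j′
  Q = quad i (suc i) j′ j
  agrees : ∀ x → i ≤ x → x ≤ j → contribution x Q +₃ quiddityAt (B ++ []) x ≡ c x
  agrees x i≤x x≤j =
    trans (cong₂ _+₃_ (contribution-quad x i (suc i) j′ j) (quiddityAt-++ B [] x))
          (trans (+₃-identityˡ _) (trans (+₃-identityʳ (quiddityAt B x))
                 (by-position (m≤n⇒m<n∨m≡n i≤x) (m≤n⇒m<n∨m≡n x≤j))))
    where
    by-position : i < x ⊎ i ≡ x → x < j ⊎ x ≡ j → quiddityAt B x ≡ c x
    by-position (inj₂ refl) _ = trans (quiddity-outside DB (inj₁ (n<1+n i))) (sym ci≡0)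
    by-position (inj₁ _) (inj₂ refl) = trans (quiddity-outside DB (inj₂ (n<1+n j′))) (sym cj≡0)
    by-position (inj₁ i<x) (inj₁ (s≤s x≤j′)) = B-agrees x i<x x≤j′

dissect : ∀ n {i j} c → suc n + i ≡ j → frame c i j ≋ [] → QuiddityDissection c i j
dissect zero c refl h = digon-step c h
dissect (suc n) {i} c refl h with c i ≟₃ 0₃ | c (suc (suc n) + i) ≟₃ 0₃
... | no ci≢0 | _ = attach-first-ear n c s ci≡ε
      (dissect n (c ⊖ firstEar n i s) (cong suc (+-suc n i)) (cut-first-ear n c s ci≡ε h))
  where open Σ (nonzero-sign ci≢0) renaming (proj₁ to s; proj₂ to ci≡ε)
... | yes _ | no cj≢0 = attach-last-ear n c s cj≡ε
      (dissect n (c ⊖ lastEar n i s) refl (cut-last-ear n c s cj≡ε h))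
  where open Σ (nonzero-sign cj≢0) renaming (proj₁ to s; proj₂ to cj≡ε)
dissect (suc zero) c refl h | yes ci≡0 | yes cj≡0 = ⊥-elim (no-zero-ended-triangle c ci≡0 cj≡0 h)
dissect (suc (suc m)) {i} c refl h | yes ci≡0 | yes cj≡0 = attach-quadrilateral m c ci≡0 cj≡0
  (dissect m c (cong suc (+-suc m i)) (cut-quadrilateral m c ci≡0 cj≡0 h))

vertexLabel : ∀ {n} → Vec Z3 n → ℕ → Z3
vertexLabel [] _ = 0₃
vertexLabel (_ ∷ _) zero = 0₃
vertexLabel (a ∷ _) (suc zero) = a
vertexLabel (_ ∷ v) (suc (suc x)) = vertexLabel v (suc x)

tabulate-vertexLabel : ∀ {n} (v : Vec Z3 n) → tabulate (λ t → vertexLabel v (suc (toℕ t))) ≡ v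
tabulate-vertexLabel v = trans (tabulate-cong (label-lookup v)) (tabulate∘lookup v)
  where
  label-lookup : ∀ {n} (v : Vec Z3 n) t → vertexLabel v (suc (toℕ t)) ≡ lookup v t
  label-lookup (_ ∷ _) zero = refl
  label-lookup (_ ∷ v) (suc t) = label-lookup v t

solutions-are-quiddities : ∀ n → 1 < n → (a : Vec Z3 n) → IsSolutionE3 a →
  ∃ (λ (A : List Cell) → Decomposition n A × quiddity n A ≡ a)
solutions-are-quiddities n@(suc (suc d)) 1<n@(s≤s (s≤s _)) a sol =
  read-off (dissect d (vertexLabel a) (+-comm (suc d) 1) a-closed)
  where
  a-closed : frame (vertexLabel a) 1 n ≋ []
  a-closed = solution⇒closed n (vertexLabel a) 1<n (subst IsSolutionE3 (sym (tabulate-vertexLabel a)) sol)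
  read-off : QuiddityDissection (vertexLabel a) 1 n → ∃ (λ (A : List Cell) → Decomposition n A × quiddity n A ≡ a)
  read-off (A , D , agrees) =
    A , D , trans (tabulate-cong (λ t → agrees (suc (toℕ t)) (s≤s z≤n) (toℕ<n t))) (tabulate-vertexLabel a)

quiddities-are-solutions : ∀ n → 1 < n → (A : List Cell) → Decomposition n A → IsSolutionE3 (quiddity n A)
quiddities-are-solutions n 1<n A D = closed⇒solution n (quiddityAt A) 1<n (closed D)

mainTheorem4 : (n : ℕ) → 3 ≤ n →
    ((a : Vec Z3 n) → IsSolutionE3 a →
       ∃ (λ (A : List Cell) → Decomposition n A × quiddity n A ≡ a))
    × ((A : List Cell) → Decomposition n A → IsSolutionE3 (quiddity n A))
mainTheorem4 n 3≤n = solutions-are-quiddities n 1<n , quiddities-are-solutions n 1<n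
  where
  1<n : 1 < n
  1<n = <-≤-trans (s≤s (s≤s z≤n)) 3≤n
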